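{- Let $G$ be a graph with two terminal vertices and let $(T,\mathcal{X})$ be a nice tree decomposition of $G$ of width $w$. Assume: (A1) $G$ has no parallel edges; (A2) for every leaf bag $X_i$ of $T$ with parent $X_j$, $X_i\supsetneq X_j$; (A3) $T$ has more than one bag. Then either $T$ is a path, or there is a leaf bag $X_i$ with parent $X_j$ such that the vertex in $X_i\setminus X_j$ is not a terminal.
   Context: A tree decomposition of $G=(V,E)$ is a pair $(T,\mathcal{X})$ with $T$ a tree and $\mathcal{X}=(X_t)_{t\in V(T)}$ subsets of $V$ (bags) such that every vertex lies in some bag, every edge has both ends in some bag, and for $t,t',t''$ on a path of $T$ in that order, $X_t\cap X_{t''}\subseteq X_{t'}$; its width is the maximum bag size minus one. It is nice if for any two adjacent bags $X_i,X_j$, either $X_i=X_j$, or $X_i=X_j\cup\{v\}$, or $X_j=X_i\cup\{v\}$ for a single vertex $v$. A leaf bag is a bag at a degree-one node of $T$, and its parent is the bag at its unique neighbor in $T$. -}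

module Defs where

open import Data.Nat using (ℕ; suc; _≤_)
open import Data.Fin using (Fin)
open import Data.Fin.Subset using (Subset; _∈_; _∉_; _⊆_; _⊂_; _∪_; _∩_; ⁅_⁆; ∣_∣)
open import Data.List using (List; []; _∷_)
import Data.List.Membership.Propositional as LM
open import Data.List.Relation.Unary.Unique.Propositional using (Unique)
open import Data.Product using (Σ; ∃; ∃-syntax; _×_; _,_; proj₁; proj₂)
open import Data.Sum using (_⊎_)
open import Relation.Binary.PropositionalEquality using (_≡_)
open import Relation.Nullary using (¬_)

record Graph : Set where
  field
    n    : ℕ
    m    : ℕ
    ends : Fin m → Fin n × Fin n

NoParallelEdges : Graph → Set
NoParallelEdges G = ∀ e e' →
  ((proj₁ (ends e) ≡ proj₁ (ends e') × proj₂ (ends e) ≡ proj₂ (ends e'))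
   ⊎ (proj₁ (ends e) ≡ proj₂ (ends e') × proj₂ (ends e) ≡ proj₁ (ends e')))
  → e ≡ e'
  where open Graph G

data WalkList {k : ℕ} (Adj : Fin k → Fin k → Set) : Fin k → Fin k → List (Fin k) → Set where
  single : ∀ a → WalkList Adj a a (a ∷ [])
  step   : ∀ {a b c p} → Adj a b → WalkList Adj b c p → WalkList Adj a c (a ∷ p)

IsPath : {k : ℕ} → (Fin k → Fin k → Set) → Fin k → Fin k → List (Fin k) → Set
IsPath Adj a b p = WalkList Adj a b p × Unique p

record IsTree {k : ℕ} (Adj : Fin k → Fin k → Set) : Set where
  field
    sym      : ∀ a b → Adj a b → Adj b a
    irrefl   : ∀ a → ¬ Adj a a
    conn     : ∀ a b → ∃[ p ] IsPath Adj a b p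
    uniqPath : ∀ a b p q → IsPath Adj a b p → IsPath Adj a b q → p ≡ q

data Consecutive {k : ℕ} : Fin k → Fin k → List (Fin k) → Set where
  here  : ∀ {a b p} → Consecutive a b (a ∷ b ∷ p)
  there : ∀ {a b c p} → Consecutive a b p → Consecutive a b (c ∷ p)

IsPathGraph : {k : ℕ} → (Fin k → Fin k → Set) → Set
IsPathGraph {k} Adj = ∃[ a ] ∃[ b ] ∃[ p ] (IsPath Adj a b p
  × (∀ (x : Fin k) → x LM.∈ p)
  × (∀ x y → Adj x y → Consecutive x y p ⊎ Consecutive y x p))

record TreeDecomposition (G : Graph) : Set₁ where
  open Graph G
  field
    k      : ℕ
    Adj    : Fin k → Fin k → Set
    tree   : IsTree Adj
    X      : Fin k → Subset n
    vertexCovered : ∀ (v : Fin n) → ∃[ t ] v ∈ X t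
    edgeCovered   : ∀ (e : Fin m) → ∃[ t ] (proj₁ (ends e) ∈ X t × proj₂ (ends e) ∈ X t)
    coherent : ∀ t t'' p → IsPath Adj t t'' p → ∀ t' → t' LM.∈ p → X t ∩ X t'' ⊆ X t'

module _ {G : Graph} where
  open Graph G
  open TreeDecomposition

  HasWidth : TreeDecomposition G → ℕ → Set
  HasWidth D w = (∀ t → ∣ X D t ∣ ≤ suc w) × (∃[ t ] ∣ X D t ∣ ≡ suc w)

  IsNice : TreeDecomposition G → Set
  IsNice D = ∀ i j → Adj D i j →
    (X D i ≡ X D j)
    ⊎ (∃[ v ] (v ∉ X D j × X D i ≡ X D j ∪ ⁅ v ⁆))
    ⊎ (∃[ v ] (v ∉ X D i × X D j ≡ X D i ∪ ⁅ v ⁆))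

  LeafWithParent : (D : TreeDecomposition G) → Fin (k D) → Fin (k D) → Set
  LeafWithParent D i j = Adj D i j × (∀ j' → Adj D i j' → j' ≡ j)

-- A tree that is not a path has three leaves.  By (A2) every leaf i owns a
-- vertex of X i outside its parent's bag, and by coherence such a vertex lies in
-- no other bag, since the path from i to any other node passes through the
-- parent.  Three leaves thus own three distinct vertices, at most two of which
-- are terminals.
module Submission where

open import Defs
open import Data.Nat using (ℕ; _≤_; _≥_; s≤s)
open import Data.Nat.Properties using (n≮n)
open import Data.Fin using (Fin; zero; suc; fromℕ<)
open import Data.Fin.Properties using (_≟_; all?; ¬∀⟶∃¬)
open import Data.Fin.Subset using (_∈_; _∉_; _⊂_)
open import Data.Fin.Subset.Properties using (x∈p∩q⁺)
open import Data.List using (List; []; _∷_; length; allFin; filter)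
open import Data.List.Extrema.Nat using (argmax; argmax-all; f[xs]≤f[argmax])
open import Data.List.Membership.Propositional using () renaming (_∈_ to _∈ˡ_; _∉_ to _∉ˡ_)
open import Data.List.Membership.Propositional.Properties using (∈-allFin; ∈-filter⁺; ∈-filter⁻)
import Data.List.Membership.DecPropositional as DecMembership
open import Data.List.Relation.Binary.Subset.Propositional using () renaming (_⊆_ to _⊆ˡ_)
open import Data.List.Relation.Unary.Any using (here; there)
import Data.List.Relation.Unary.All as All
open import Data.List.Relation.Unary.All.Properties.Core using (¬Any⇒All¬)
open import Data.List.Relation.Unary.AllPairs using ([]; _∷_)
open import Data.List.Relation.Unary.Unique.Propositional using (Unique)
open import Data.Product using (∃-syntax; _×_; _,_; proj₁; proj₂)
open import Data.Sum using (_⊎_; inj₁; inj₂)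
import Data.Sum as Sum
open import Data.Empty using (⊥-elim)
open import Function using (_∘_)
open import Level using (0ℓ)
open import Relation.Nullary using (yes; no)
open import Relation.Unary using (Pred; Decidable)
open import Relation.Binary.Definitions using (DecidableEquality)
open import Relation.Binary.PropositionalEquality using (_≡_; _≢_; refl; sym; cong; subst)

maximise : ∀ {k} (f : Fin k → ℕ) {P : Pred (Fin k) 0ℓ} → Decidable P →
           ∀ {z} → P z → ∃[ c ] (P c × (∀ x → P x → f x ≤ f c))
maximise {k} f {P} P? {z} pz =
  c , argmax-all f {P = P} pz (All.tabulate (proj₂ ∘ ∈-filter⁻ P? {xs = allFin k})) ,
  λ x px → All.lookup (f[xs]≤f[argmax] z candidates) (∈-filter⁺ P? (∈-allFin x) px)
  where
  candidates : List (Fin k)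
  candidates = filter P? (allFin k)
  c : Fin k
  c = argmax f z candidates

other-than : ∀ {k} → 2 ≤ k → (a : Fin k) → ∃[ b ] b ≢ a
other-than (s≤s (s≤s _)) zero    = suc zero , λ ()
other-than (s≤s (s≤s _)) (suc _) = zero , λ ()

head-∉-tail : ∀ {A : Set} {x : A} {xs} → Unique (x ∷ xs) → x ∉ˡ xs
head-∉-tail (x≢xs ∷ _) x∈xs = All.lookup x≢xs x∈xs refl

consecutive-∈ : ∀ {k} {x y : Fin k} {p} → Consecutive x y p → x ∈ˡ p
consecutive-∈ here      = here refl
consecutive-∈ (there c) = there (consecutive-∈ c)

successor-unique : ∀ {k} {x y z : Fin k} {p} → Unique p →
                   Consecutive x y p → Consecutive x z p → y ≡ z
successor-unique _        here       here       = refl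
successor-unique u        here       (there c)  = ⊥-elim (head-∉-tail u (consecutive-∈ c))
successor-unique u        (there c)  here       = ⊥-elim (head-∉-tail u (consecutive-∈ c))
successor-unique (_ ∷ u)  (there c)  (there d)  = successor-unique u c d

module Walks {k} {Adj : Fin k → Fin k → Set} where

  walk-start∈ : ∀ {a b p} → WalkList Adj a b p → a ∈ˡ p
  walk-start∈ (single _) = here refl
  walk-start∈ (step _ _) = here refl

  walk-end∈ : ∀ {a b p} → WalkList Adj a b p → b ∈ˡ p
  walk-end∈ (single _) = here refl
  walk-end∈ (step _ w) = there (walk-end∈ w)

  walk-start-follows : ∀ {a b x p} → WalkList Adj a b p → Consecutive x a (x ∷ p)
  walk-start-follows (single _) = here
  walk-start-follows (step _ _) = here

  extend : ∀ {x a b p} → Adj x a → x ∉ˡ p → IsPath Adj a b p → IsPath Adj x b (x ∷ p)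
  extend adj x∉p (w , u) = step adj w , ¬Any⇒All¬ _ x∉p ∷ u

  path-suffix : ∀ {a b y p} → IsPath Adj a b p → y ∈ˡ p →
                ∃[ s ] (IsPath Adj y b s × s ⊆ˡ p)
  path-suffix P@(single _ , _)   (here refl) = _ , P , λ z∈ → z∈
  path-suffix P@(step _ _ , _)   (here refl) = _ , P , λ z∈ → z∈
  path-suffix (single _ , _)     (there ())
  path-suffix (step _ w , _ ∷ u) (there y∈p) with path-suffix (w , u) y∈p
  ... | s , S , s⊆p = s , S , there ∘ s⊆p

Leaf : ∀ {k} → (Fin k → Fin k → Set) → Fin k → Set
Leaf Adj c = ∃[ u ] (Adj c u × (∀ j → Adj c j → j ≡ u))

module Tree {k} {Adj : Fin k → Fin k → Set} (T : IsTree Adj) where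
  open IsTree T renaming (sym to adj-sym)
  open Walks {Adj = Adj}
  open DecMembership {A = Fin k} _≟_ using (_∈?_; _∉?_)

  path : Fin k → Fin k → List (Fin k)
  path a b = proj₁ (conn a b)

  path-isPath : ∀ a b → IsPath Adj a b (path a b)
  path-isPath a b = proj₂ (conn a b)

  path-unique : ∀ {a b p} → IsPath Adj a b p → path a b ≡ p
  path-unique P = uniqPath _ _ _ _ (path-isPath _ _) P

  dist : Fin k → Fin k → ℕ
  dist ρ x = length (path x ρ)

  neighbour-on-path-is-next : ∀ {a b x y q} → IsPath Adj a b (x ∷ q) → Adj x y → y ∈ˡ q →
                              Consecutive x y (x ∷ q)
  neighbour-on-path-is-next (single _ , _) _ ()
  neighbour-on-path-is-next (step adj₀ w , u@(_ ∷ uq)) adj y∈q with path-suffix (w , uq) y∈q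
  ... | s , (ws , us) , s⊆q =
    subst (Consecutive _ _)
          (uniqPath _ _ _ _ (extend adj (head-∉-tail u ∘ s⊆q) (ws , us)) (step adj₀ w , u))
          (walk-start-follows ws)

  edge-on-path-consecutive : ∀ {a b x y p} → IsPath Adj a b p → Adj x y → x ∈ˡ p → y ∈ˡ p →
                             Consecutive x y p ⊎ Consecutive y x p
  edge-on-path-consecutive _ adj (here refl) (here refl) = ⊥-elim (irrefl _ adj)
  edge-on-path-consecutive P adj (here refl) (there y∈) = inj₁ (neighbour-on-path-is-next P adj y∈)
  edge-on-path-consecutive P adj (there x∈) (here refl) =
    inj₂ (neighbour-on-path-is-next P (adj-sym _ _ adj) x∈)
  edge-on-path-consecutive (single _ , _) _ (there ()) (there _)
  edge-on-path-consecutive (step _ w , _ ∷ u) adj (there x∈) (there y∈) =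
    Sum.map there there (edge-on-path-consecutive (w , u) adj x∈ y∈)

  spanning-path⇒path-graph : ∀ {a b p} → IsPath Adj a b p → (∀ x → x ∈ˡ p) → IsPathGraph Adj
  spanning-path⇒path-graph P spans =
    _ , _ , _ , P , spans , λ x y adj → edge-on-path-consecutive P adj (spans x) (spans y)

  path-to-end-⊆ : ∀ {b r j p} → IsPath Adj b r p → j ∈ˡ p → path j r ⊆ˡ p
  path-to-end-⊆ P j∈p with path-suffix P j∈p
  ... | _ , S , s⊆p = s⊆p ∘ subst (_ ∈ˡ_) (path-unique S)

  path-via-neighbour : ∀ {j c r} → Adj j c → j ∉ˡ path c r → path j r ≡ j ∷ path c r
  path-via-neighbour adj j∉ = path-unique (extend adj j∉ (path-isPath _ _))

  leaf-if-neighbours-on-path : ∀ {c ρ p} → IsPath Adj c ρ p → c ≢ ρ →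
                               (∀ j → Adj c j → j ∈ˡ p) → Leaf Adj c
  leaf-if-neighbours-on-path (single _ , _) c≢ρ _ = ⊥-elim (c≢ρ refl)
  leaf-if-neighbours-on-path P@(step {b = u} adj w , uniq) _ on-path = u , adj , neighbour≡u
    where
    neighbour≡u : ∀ j → Adj _ j → j ≡ u
    neighbour≡u j adj′ with on-path j adj′
    ... | here refl = ⊥-elim (irrefl _ adj′)
    ... | there j∈  = successor-unique uniq (neighbour-on-path-is-next P adj′ j∈) (walk-start-follows w)

  leaf-if-locally-farthest : ∀ {c ρ} → c ≢ ρ →
                             (∀ j → Adj c j → j ∉ˡ path c ρ → dist ρ j ≤ dist ρ c) → Leaf Adj c
  leaf-if-locally-farthest {c} {ρ} c≢ρ farthest =
    leaf-if-neighbours-on-path (path-isPath c ρ) c≢ρ on-path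
    where
    on-path : ∀ j → Adj c j → j ∈ˡ path c ρ
    on-path j adj with j ∈? path c ρ
    ... | yes j∈ = j∈
    ... | no j∉  = ⊥-elim (n≮n _ (subst (_≤ dist ρ c)
                     (cong length (path-via-neighbour (adj-sym _ _ adj) j∉)) (farthest j adj j∉)))

  -- The node off the path farthest from r is a leaf: a neighbour off its own
  -- route to r would also be off the path, and one step farther from r.
  leaf-off-path : ∀ {b r z} → z ∉ˡ path b r → ∃[ c ] (c ∉ˡ path b r × Leaf Adj c)
  leaf-off-path {b} {r} z∉ with maximise (dist r) (_∉? path b r) z∉
  ... | c , c∉ , maximal = c , c∉ , leaf-if-locally-farthest c≢r farthest
    where
    c≢r : c ≢ r
    c≢r refl = c∉ (walk-end∈ (proj₁ (path-isPath b r)))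
    farthest : ∀ j → Adj c j → j ∉ˡ path c r → dist r j ≤ dist r c
    farthest j adj j∉ = maximal j λ j∈ → c∉ (path-to-end-⊆ (path-isPath b r) j∈
      (subst (c ∈ˡ_) (sym (path-via-neighbour (adj-sym _ _ adj) j∉))
             (there (walk-start∈ (proj₁ (path-isPath c r))))))

  path-self : ∀ ρ → path ρ ρ ≡ ρ ∷ []
  path-self ρ = path-unique (single ρ , All.[] ∷ [])

  other-leaf : 2 ≤ k → ∀ ρ → ∃[ r ] (r ≢ ρ × Leaf Adj r)
  other-leaf k≥2 ρ with other-than k≥2 ρ
  ... | z , z≢ρ with leaf-off-path {ρ} {ρ} (subst (z ∉ˡ_) (sym (path-self ρ)) λ { (here z≡ρ) → z≢ρ z≡ρ })
  ... | r , r∉ , leaf = r , (λ { refl → r∉ (walk-start∈ (proj₁ (path-isPath r r))) }) , leaf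

  path-graph-or-three-leaves : 2 ≤ k → IsPathGraph Adj ⊎
    ∃[ a ] ∃[ b ] ∃[ c ] (Leaf Adj a × Leaf Adj b × Leaf Adj c × a ≢ b × a ≢ c × b ≢ c)
  path-graph-or-three-leaves k≥2 with other-leaf k≥2 (fromℕ< k≥2)
  ... | a , _ , leaf-a with other-leaf k≥2 a
  ... | b , b≢a , leaf-b with all? (_∈? path b a)
  ... | yes spans = inj₁ (spanning-path⇒path-graph (path-isPath b a) spans)
  ... | no misses with leaf-off-path (proj₂ (¬∀⟶∃¬ k _ (_∈? path b a) misses))
  ... | c , c∉ , leaf-c = inj₂ (a , b , c , leaf-a , leaf-b , leaf-c , b≢a ∘ sym ,
          (λ { refl → c∉ (walk-end∈ (proj₁ (path-isPath b a))) }) ,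
          (λ { refl → c∉ (walk-start∈ (proj₁ (path-isPath b a))) }))

module _ {A : Set} (_≟ᴬ_ : DecidableEquality A) (P : A → Set) where

  avoid-two : ∀ s t {x y z} → P x → P y → P z → x ≢ y → x ≢ z → y ≢ z →
              ∃[ v ] (P v × v ≢ s × v ≢ t)
  avoid-two s t {x} {y} {z} px py pz x≢y x≢z y≢z with x ≟ᴬ s | x ≟ᴬ t
  ... | no x≢s   | no x≢t = x , px , x≢s , x≢t
  ... | yes refl | _ with y ≟ᴬ t
  ...   | no y≢t   = y , py , x≢y ∘ sym , y≢t
  ...   | yes refl = z , pz , x≢z ∘ sym , y≢z ∘ sym
  avoid-two s t {x} {y} {z} px py pz x≢y x≢z y≢z | no _ | yes refl with y ≟ᴬ s
  ...   | no y≢s   = y , py , y≢s , x≢y ∘ sym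
  ...   | yes refl = z , pz , y≢z ∘ sym , x≢z ∘ sym

module _ {G : Graph} (D : TreeDecomposition G) where
  open Graph G using (n)
  open TreeDecomposition D
  open Walks {Adj = Adj}

  PrivateVertex : Fin k → Fin n → Set
  PrivateVertex i v = ∃[ j ] (LeafWithParent D i j × v ∈ X i × v ∉ X j)

  private-vertex-of-leaf : (∀ i j → LeafWithParent D i j → X j ⊂ X i) →
                           ∀ {i} → Leaf Adj i → ∃[ v ] PrivateVertex i v
  private-vertex-of-leaf strict (j , leaf) with strict _ j leaf
  ... | _ , v , v∈ , v∉ = v , j , leaf , v∈ , v∉

  private-vertex-confined : ∀ {i l v} → PrivateVertex i v → l ≢ i → v ∉ X l
  private-vertex-confined {i} {l} (j , (_ , parent) , v∈ , v∉) l≢i v∈l with IsTree.conn tree i l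
  ... | _ , single _ , _ = l≢i refl
  ... | _ , P@(step adj w , _) =
    v∉ (subst (λ y → _ ∈ X y) (parent _ adj)
              (coherent i l _ P _ (there (walk-start∈ w)) (x∈p∩q⁺ (v∈ , v∈l))))

  private-vertices-distinct : ∀ {i l u v} → i ≢ l → PrivateVertex i u → PrivateVertex l v → u ≢ v
  private-vertices-distinct i≢l pu (_ , _ , v∈ , _) refl = private-vertex-confined pu (i≢l ∘ sym) v∈

  non-terminal-private-vertex :
    (∀ i j → LeafWithParent D i j → X j ⊂ X i) → ∀ s t {a b c} →
    Leaf Adj a → Leaf Adj b → Leaf Adj c → a ≢ b → a ≢ c → b ≢ c →
    ∃[ i ] ∃[ j ] (LeafWithParent D i j × ∃[ v ] (v ∈ X i × v ∉ X j × v ≢ s × v ≢ t))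
  non-terminal-private-vertex strict s t {a} {b} {c} leaf-a leaf-b leaf-c a≢b a≢c b≢c
    with private-vertex-of-leaf strict leaf-a | private-vertex-of-leaf strict leaf-b
       | private-vertex-of-leaf strict leaf-c
  ... | u , pu | v , pv | w , pw
    with avoid-two _≟_ (λ x → ∃[ i ] PrivateVertex i x) s t (a , pu) (b , pv) (c , pw)
           (private-vertices-distinct a≢b pu pv) (private-vertices-distinct a≢c pu pw)
           (private-vertices-distinct b≢c pv pw)
  ... | x , (i , j , leaf , x∈ , x∉) , x≢s , x≢t = i , j , leaf , x , x∈ , x∉ , x≢s , x≢t

lemma6 : (G : Graph) (s t : Fin (Graph.n G)) → s ≢ t
    → (D : TreeDecomposition G) (w : ℕ) → IsNice D → HasWidth D w
    → NoParallelEdges G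
    → (∀ i j → LeafWithParent D i j → TreeDecomposition.X D j ⊂ TreeDecomposition.X D i)
    → TreeDecomposition.k D ≥ 2
    → IsPathGraph (TreeDecomposition.Adj D)
      ⊎ (∃[ i ] ∃[ j ] (LeafWithParent D i j × ∃[ v ] (v ∈ TreeDecomposition.X D i × v ∉ TreeDecomposition.X D j × v ≢ s × v ≢ t)))
lemma6 G s t _ D _ _ _ _ strict k≥2 =
  Sum.map₂ (λ (_ , _ , _ , leaf-a , leaf-b , leaf-c , a≢b , a≢c , b≢c) →
              non-terminal-private-vertex D strict s t leaf-a leaf-b leaf-c a≢b a≢c b≢c)
           (Tree.path-graph-or-three-leaves (TreeDecomposition.tree D) k≥2)
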